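{- Let $p$ be a prime and $R=a^2f^2-abef-2acdf+ace^2+b^2df-bcde+c^2d^2\in\mathbb{Z}[a,b,c,d,e,f]$. Then $$\#\{(a,b,c,d,e,f)\in(\mathbb{Z}/p\mathbb{Z})^6:R(a,b,c,d,e,f)=0\}\le 2p^5-p^3.$$
   Context: $R$ is the resultant of $aX^2+bXY+cY^2$ and $dX^2+eXY+fY^2$. -}

module Defs where

open import Data.Nat as ℕ using (ℕ; NonZero; _≟_)
open import Data.Fin using (Fin; toℕ)
open import Data.Integer using (ℤ; +_; _+_; _-_; _*_)
open import Data.Integer.DivMod using (_%ℕ_)
open import Data.List using (List; []; _∷_; allFin; cartesianProduct; filter; length)
open import Data.Product using (_×_; _,_)
open import Relation.Unary using (Pred; Decidable)
open import Relation.Binary.PropositionalEquality using (_≡_)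
open import Level using (0ℓ)

-- The resultant R ∈ ℤ[a,b,c,d,e,f] of aX²+bXY+cY² and dX²+eXY+fY²:
-- R = a²f² − abef − 2acdf + ace² + b²df − bcde + c²d².
R : ℤ → ℤ → ℤ → ℤ → ℤ → ℤ → ℤ
R a b c d e f =
  a * a * f * f - a * b * e * f - + 2 * a * c * d * f + a * c * e * e
  + b * b * d * f - b * c * d * e + c * c * d * d

-- Points of (ℤ/pℤ)^6; an element of ℤ/pℤ is represented by its
-- residue in Fin p (0 .. p-1).
Point : ℕ → Set
Point p = Fin p × Fin p × Fin p × Fin p × Fin p × Fin p

allPoints : (p : ℕ) → List (Point p)
allPoints p =
  cartesianProduct xs (cartesianProduct xs (cartesianProduct xs
    (cartesianProduct xs (cartesianProduct xs xs))))
  where xs = allFin p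

RZero : (p : ℕ) .{{_ : NonZero p}} → Pred (Point p) 0ℓ
RZero p (a , b , c , d , e , f) =
  (R (+ toℕ a) (+ toℕ b) (+ toℕ c) (+ toℕ d) (+ toℕ e) (+ toℕ f) %ℕ p) ≡ 0

RZero? : (p : ℕ) .{{_ : NonZero p}} → Decidable (RZero p)
RZero? p (a , b , c , d , e , f) =
  (R (+ toℕ a) (+ toℕ b) (+ toℕ c) (+ toℕ d) (+ toℕ e) (+ toℕ f) %ℕ p) ≟ 0

zeroCount : (p : ℕ) .{{_ : NonZero p}} → ℕ
zeroCount p = length (filter (RZero? p) (allPoints p))

{-# OPTIONS --safe #-}
-- For fixed a, b, c, d, e the resultant is the quadratic
-- a² f² + (b² d − a b e − 2 a c d) f + c (a e² − b d e + c d²) in f.  Over the field ℤ/p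
-- it has at most two roots f if a ≠ 0; if a = 0 it is linear with slope b² d, so it has at
-- most one root when b, d ≠ 0; if a = b = 0 it is the constant c² d², so it has no root
-- when c, d ≠ 0.  Bounding the remaining fibres trivially by p and summing over (a, …, e)
-- gives 2 (p − 1) p⁴ + (p − 1) p (2 p² − p) + (2 p³ − p²) = 2 p⁵ − p³.
module Submission where

open import Defs
open import Data.Empty using (⊥-elim)
open import Data.Fin using (Fin; zero; suc; toℕ)
open import Data.Fin.Properties using (toℕ<n; toℕ-injective)
open import Data.Integer using (ℤ; +_) renaming (∣_∣ to abs)
open import Data.List
  using (List; []; _∷_; _++_; length; filter; map; tabulate; allFin; cartesianProduct)
open import Data.List.Properties using (length-++; filter-++; length-filter; length-tabulate)
open import Data.List.Relation.Unary.All using (All; []; _∷_)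
open import Data.List.Relation.Unary.All.Properties using (all-filter)
open import Data.List.Relation.Unary.AllPairs using ([]; _∷_)
open import Data.List.Relation.Unary.Unique.Propositional using (Unique)
import Data.List.Relation.Unary.Unique.Propositional.Properties as Unique
open import Data.Nat as ℕ using (ℕ; zero; suc; _≤_; _<_; z≤n; s≤s; NonZero)
open import Data.Nat.Divisibility using (>⇒∤) renaming (_∣_ to _∣ℕ_)
open import Data.Nat.Primality using (Prime; prime⇒nonZero; euclidsLemma)
open import Data.Nat.Properties
  using (+-0-monoid; ≤-trans; ≤-reflexive; +-mono-≤; ⊔-lub; ≤-<-trans; m+n≤o⇒m≤o∸n)
open import Algebra.Properties.Monoid.Sum +-0-monoid using (sum-syntax)
open import Data.Product using (_×_; _,_)
open import Data.Sum as Sum using (_⊎_; inj₁; inj₂; [_,_]′)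
open import Function using (_∘_; id)
open import Level using (Level; 0ℓ)
open import Relation.Nullary using (¬_; yes; no)
open import Relation.Unary using (Pred; Decidable)
open import Relation.Binary.PropositionalEquality
  using (_≡_; refl; sym; trans; cong; cong₂; subst; module ≡-Reasoning)

private
  variable
    a b ℓ : Level
    A : Set a
    B : Set b

module _ {P : Pred A ℓ} where

  length≤0 : ∀ {xs} → All P xs → (∀ {x} → ¬ P x) → length xs ≤ 0
  length≤0 []       ¬P = z≤n
  length≤0 (px ∷ _) ¬P = ⊥-elim (¬P px)

  length≤1 : ∀ {xs} → Unique xs → All P xs → (∀ {x y} → P x → P y → x ≡ y) → length xs ≤ 1
  length≤1 _               []            _   = z≤n
  length≤1 _               (_ ∷ [])      _   = s≤s z≤n
  length≤1 ((x≢y ∷ _) ∷ _) (px ∷ py ∷ _) P≤1 = ⊥-elim (x≢y (P≤1 px py))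

  length≤2 : ∀ {xs} → Unique xs → All P xs →
             (∀ {x y z} → P x → P y → P z → x ≡ y ⊎ x ≡ z ⊎ y ≡ z) → length xs ≤ 2
  length≤2 _ []           _ = z≤n
  length≤2 _ (_ ∷ [])     _ = s≤s z≤n
  length≤2 _ (_ ∷ _ ∷ []) _ = s≤s (s≤s z≤n)
  length≤2 ((x≢y ∷ x≢z ∷ _) ∷ (y≢z ∷ _) ∷ _) (px ∷ py ∷ pz ∷ _) P≤2 =
    ⊥-elim ([ x≢y , [ x≢z , y≢z ]′ ]′ (P≤2 px py pz))

∑-mono-≤ : ∀ {n} {f g : Fin n → ℕ} → (∀ i → f i ≤ g i) → ∑[ i < n ] f i ≤ ∑[ i < n ] g i
∑-mono-≤ {zero}  f≤g = z≤n
∑-mono-≤ {suc n} f≤g = +-mono-≤ (f≤g zero) (∑-mono-≤ (f≤g ∘ suc))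

∑-const : ∀ n {f : Fin n → ℕ} {k} → (∀ i → f i ≡ k) → ∑[ i < n ] f i ≡ n ℕ.* k
∑-const zero    f≡k = refl
∑-const (suc n) f≡k = cong₂ ℕ._+_ (f≡k zero) (∑-const n (f≡k ∘ suc))

module _ {P : Pred (A × B) ℓ} (P? : Decidable P) where

  length-filter-map-, : ∀ x ys →
    length (filter P? (map (x ,_) ys)) ≡ length (filter (λ y → P? (x , y)) ys)
  length-filter-map-, x []       = refl
  length-filter-map-, x (y ∷ ys) with P? (x , y)
  ... | yes _ = cong suc (length-filter-map-, x ys)
  ... | no  _ = length-filter-map-, x ys

  length-filter-cartesianProduct : ∀ {n} (f : Fin n → A) ys →
    length (filter P? (cartesianProduct (tabulate f) ys))
      ≡ ∑[ i < n ] length (filter (λ y → P? (f i , y)) ys)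
  length-filter-cartesianProduct {zero}  f ys = refl
  length-filter-cartesianProduct {suc n} f ys = begin
    length (filter P? (map (f zero ,_) ys ++ rest))
      ≡⟨ cong length (filter-++ P? (map (f zero ,_) ys) rest) ⟩
    length (filter P? (map (f zero ,_) ys) ++ filter P? rest)
      ≡⟨ length-++ (filter P? (map (f zero ,_) ys)) ⟩
    length (filter P? (map (f zero ,_) ys)) ℕ.+ length (filter P? rest)
      ≡⟨ cong₂ ℕ._+_ (length-filter-map-, (f zero) ys)
                     (length-filter-cartesianProduct (f ∘ suc) ys) ⟩
    _ ∎
    where
    open ≡-Reasoning
    rest : List (A × B)
    rest = cartesianProduct (tabulate (f ∘ suc)) ys

  length-filter-cartesianProduct≤ : ∀ {n} (f : Fin n → A) ys {g : Fin n → ℕ} →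
    (∀ i → length (filter (λ y → P? (f i , y)) ys) ≤ g i) →
    length (filter P? (cartesianProduct (tabulate f) ys)) ≤ ∑[ i < n ] g i
  length-filter-cartesianProduct≤ f ys fibre≤g =
    ≤-trans (≤-reflexive (length-filter-cartesianProduct f ys)) (∑-mono-≤ fibre≤g)

module _ where
  open import Data.Integer using (_+_; _-_; _*_)
  open import Data.Integer.DivMod using (_%ℕ_; _/ℕ_; a≡a%ℕn+[a/ℕn]*n)
  open import Data.Integer.Divisibility.Signed
    using (_∣_; divides; ∣⇒∣ᵤ; ∣ᵤ⇒∣; ∣m∣n⇒∣m+n; ∣m∣n⇒∣m-n; ∣m+n∣m⇒∣n; ∣m⇒∣m*n)
  open import Data.Integer.Properties
    using (+-identityˡ; abs-*; ∣i∣≡0⇒i≡0; i-j≡0⇒i≡j; +-injective; m-n≡m⊖n; ∣m⊝n∣≤m⊔n)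
  open import Data.Integer.Tactic.RingSolver using (solve-∀)

  toℤ : ∀ {n} → Fin n → ℤ
  toℤ i = + toℕ i

  %ℕ≡0⇒∣ : ∀ x p .{{_ : NonZero p}} → x %ℕ p ≡ 0 → + p ∣ x
  %ℕ≡0⇒∣ x p x%p≡0 = divides (x /ℕ p) (begin
    x                             ≡⟨ a≡a%ℕn+[a/ℕn]*n x p ⟩
    + (x %ℕ p) + (x /ℕ p) * + p   ≡⟨ cong (λ r → + r + (x /ℕ p) * + p) x%p≡0 ⟩
    + 0 + (x /ℕ p) * + p          ≡⟨ +-identityˡ _ ⟩
    (x /ℕ p) * + p                ∎)
    where open ≡-Reasoning

  ∣∧<⇒≡0 : ∀ {p k} → p ∣ℕ k → k < p → k ≡ 0
  ∣∧<⇒≡0 {k = zero}  _   _   = refl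
  ∣∧<⇒≡0 {k = suc _} p∣k k<p = ⊥-elim (>⇒∤ k<p p∣k)

  ∣toℤ-toℤ⇒≡ : ∀ {p} (i j : Fin p) → + p ∣ toℤ i - toℤ j → i ≡ j
  ∣toℤ-toℤ⇒≡ {p} i j p∣i-j =
    toℕ-injective (+-injective (i-j≡0⇒i≡j _ _ (∣i∣≡0⇒i≡0 (∣∧<⇒≡0 (∣⇒∣ᵤ p∣i-j) ∣i-j∣<p))))
    where
    ∣i-j∣<p : abs (toℤ i - toℤ j) < p
    ∣i-j∣<p = ≤-<-trans
      (subst (λ k → abs k ≤ toℕ i ℕ.⊔ toℕ j) (sym (m-n≡m⊖n (toℕ i) (toℕ j)))
        (∣m⊝n∣≤m⊔n (toℕ i) (toℕ j)))
      (⊔-lub (toℕ<n i) (toℕ<n j))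

  ∤toℤ-suc : ∀ {n} (i : Fin n) → ¬ + suc n ∣ toℤ (suc i)
  ∤toℤ-suc i p∣i = >⇒∤ (toℕ<n (suc i)) (∣⇒∣ᵤ p∣i)

  module _ {p} (p-prime : Prime p) where

    ∣*⇒∣⊎∣ : ∀ x y → + p ∣ x * y → + p ∣ x ⊎ + p ∣ y
    ∣*⇒∣⊎∣ x y p∣xy = Sum.map ∣ᵤ⇒∣ ∣ᵤ⇒∣
      (euclidsLemma (abs x) (abs y) p-prime (subst (p ∣ℕ_) (abs-* x y) (∣⇒∣ᵤ p∣xy)))

    ∤∧∤⇒∤* : ∀ {x y} → ¬ + p ∣ x → ¬ + p ∣ y → ¬ + p ∣ x * y
    ∤∧∤⇒∤* {x} {y} p∤x p∤y = [ p∤x , p∤y ]′ ∘ ∣*⇒∣⊎∣ x y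

  quadratic-difference : ∀ α β γ x y →
    (α * (x * x) + β * x + γ) - (α * (y * y) + β * y + γ) ≡ (x - y) * (α * (x + y) + β)
  quadratic-difference = solve-∀

  slope-difference : ∀ α β x y z → (α * (x + y) + β) - (α * (x + z) + β) ≡ α * (y - z)
  slope-difference = solve-∀

  module QuadraticRoots (p : ℕ) (α β γ : ℤ) where

    Root : ℤ → Set
    Root x = + p ∣ α * (x * x) + β * x + γ

    module _ (p-prime : Prime p) where

      two-roots : ∀ x y → Root x → Root y → + p ∣ x - y ⊎ + p ∣ α * (x + y) + β
      two-roots x y rx ry = ∣*⇒∣⊎∣ p-prime (x - y) (α * (x + y) + β)
        (subst (+ p ∣_) (quadratic-difference α β γ x y) (∣m∣n⇒∣m-n rx ry))

      at-most-two-roots : ¬ + p ∣ α → ∀ x y z → Root x → Root y → Root z →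
                          + p ∣ x - y ⊎ + p ∣ x - z ⊎ + p ∣ y - z
      at-most-two-roots p∤α x y z rx ry rz =
        [ inj₁ , (λ p∣sxy → [ inj₂ ∘ inj₁ , inj₂ ∘ inj₂ ∘ y≡z p∣sxy ]′ (two-roots x z rx rz)) ]′
          (two-roots x y rx ry)
        where
        y≡z : + p ∣ α * (x + y) + β → + p ∣ α * (x + z) + β → + p ∣ y - z
        y≡z p∣sxy p∣sxz = [ ⊥-elim ∘ p∤α , id ]′ (∣*⇒∣⊎∣ p-prime α (y - z)
          (subst (+ p ∣_) (slope-difference α β x y z) (∣m∣n⇒∣m-n p∣sxy p∣sxz)))

      at-most-one-root : + p ∣ α → ¬ + p ∣ β → ∀ x y → Root x → Root y → + p ∣ x - y
      at-most-one-root p∣α p∤β x y rx ry =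
        [ id , ⊥-elim ∘ p∤β ∘ (λ p∣sxy → ∣m+n∣m⇒∣n p∣sxy (∣m⇒∣m*n (x + y) p∣α)) ]′
          (two-roots x y rx ry)

    no-root : + p ∣ α → + p ∣ β → ¬ + p ∣ γ → ∀ x → ¬ Root x
    no-root p∣α p∣β p∤γ x rx =
      p∤γ (∣m+n∣m⇒∣n rx (∣m∣n⇒∣m+n (∣m⇒∣m*n (x * x) p∣α) (∣m⇒∣m*n x p∣β)))

  R≡quadratic : ∀ a b c d e f → R a b c d e f ≡
    a * a * (f * f) + (b * b * d - a * b * e - + 2 * a * c * d) * f
    + c * (a * e * e - b * d * e + c * d * d)
  R≡quadratic = expand-R
    where
    -- The ring solver does not unfold R, so its body is restated.
    expand-R : ∀ a b c d e f →
      a * a * f * f - a * b * e * f - + 2 * a * c * d * f + a * c * e * e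
      + b * b * d * f - b * c * d * e + c * c * d * d ≡
      a * a * (f * f) + (b * b * d - a * b * e - + 2 * a * c * d) * f
      + c * (a * e * e - b * d * e + c * d * d)
    expand-R = solve-∀

  linear-coefficient-at-a≡0 : ∀ b c d e → b * b * d - + 0 * b * e - + 2 * + 0 * c * d ≡ b * b * d
  linear-coefficient-at-a≡0 = solve-∀

  constant-coefficient-at-a≡b≡0 : ∀ c d e →
    c * (+ 0 * e * e - + 0 * d * e + c * d * d) ≡ c * c * (d * d)
  constant-coefficient-at-a≡b≡0 = solve-∀

  module Fibre {q} (p-prime : Prime (suc q)) (a b c d e : Fin (suc q)) where

    IsRoot : Pred (Fin (suc q)) 0ℓ
    IsRoot f = RZero (suc q) (a , b , c , d , e , f)

    isRoot? : Decidable IsRoot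
    isRoot? f = RZero? (suc q) (a , b , c , d , e , f)

    roots : List (Fin (suc q))
    roots = filter isRoot? (allFin (suc q))

    α β γ : ℤ
    α = toℤ a * toℤ a
    β = toℤ b * toℤ b * toℤ d - toℤ a * toℤ b * toℤ e - + 2 * toℤ a * toℤ c * toℤ d
    γ = toℤ c * (toℤ a * toℤ e * toℤ e - toℤ b * toℤ d * toℤ e + toℤ c * toℤ d * toℤ d)

    open QuadraticRoots (suc q) α β γ

    isRoot⇒Root : ∀ {f} → IsRoot f → Root (toℤ f)
    isRoot⇒Root {f} R≡0 =
      subst (+ suc q ∣_) (R≡quadratic (toℤ a) (toℤ b) (toℤ c) (toℤ d) (toℤ e) (toℤ f))
        (%ℕ≡0⇒∣ _ (suc q) R≡0)

    roots-unique : Unique roots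
    roots-unique = Unique.filter⁺ isRoot? (Unique.allFin⁺ (suc q))

    roots-all : All IsRoot roots
    roots-all = all-filter isRoot? (allFin (suc q))

    length-roots≤p : length roots ≤ suc q
    length-roots≤p =
      ≤-trans (length-filter isRoot? (allFin (suc q))) (≤-reflexive (length-tabulate id))

    length-roots≤2 : ¬ + suc q ∣ α → length roots ≤ 2
    length-roots≤2 p∤α = length≤2 roots-unique roots-all λ {f} {g} {h} rf rg rh →
      Sum.map (∣toℤ-toℤ⇒≡ f g) (Sum.map (∣toℤ-toℤ⇒≡ f h) (∣toℤ-toℤ⇒≡ g h))
        (at-most-two-roots p-prime p∤α (toℤ f) (toℤ g) (toℤ h)
          (isRoot⇒Root rf) (isRoot⇒Root rg) (isRoot⇒Root rh))

    length-roots≤1 : + suc q ∣ α → ¬ + suc q ∣ β → length roots ≤ 1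
    length-roots≤1 p∣α p∤β = length≤1 roots-unique roots-all λ {f} {g} rf rg →
      ∣toℤ-toℤ⇒≡ f g
        (at-most-one-root p-prime p∣α p∤β (toℤ f) (toℤ g) (isRoot⇒Root rf) (isRoot⇒Root rg))

    length-roots≤0 : + suc q ∣ α → + suc q ∣ β → ¬ + suc q ∣ γ → length roots ≤ 0
    length-roots≤0 p∣α p∣β p∤γ =
      length≤0 roots-all λ {f} → no-root p∣α p∣β p∤γ (toℤ f) ∘ isRoot⇒Root

  rootBound : ∀ {q} → (a b c d : Fin (suc q)) → ℕ
  rootBound     (suc _) _       _       _       = 2
  rootBound     zero    (suc _) _       (suc _) = 1
  rootBound     zero    zero    (suc _) (suc _) = 0
  rootBound {q} zero    _       _       _       = suc q

  module _ {q} (p-prime : Prime (suc q)) where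
    open Fibre p-prime

    p∣0 : + suc q ∣ + 0
    p∣0 = divides (+ 0) refl

    ∤toℤ-suc² : ∀ (i : Fin q) → ¬ + suc q ∣ toℤ (suc i) * toℤ (suc i)
    ∤toℤ-suc² i = ∤∧∤⇒∤* p-prime (∤toℤ-suc i) (∤toℤ-suc i)

    length-roots≤rootBound : ∀ a b c d e → length (roots a b c d e) ≤ rootBound a b c d
    length-roots≤rootBound (suc a) b c d e = length-roots≤2 (suc a) b c d e (∤toℤ-suc² a)
    length-roots≤rootBound zero (suc b) c (suc d) e =
      length-roots≤1 zero (suc b) c (suc d) e p∣0
        (∤∧∤⇒∤* p-prime (∤toℤ-suc² b) (∤toℤ-suc d) ∘
          subst (+ suc q ∣_) (linear-coefficient-at-a≡0 (toℤ (suc b)) (toℤ c) (toℤ (suc d)) (toℤ e)))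
    length-roots≤rootBound zero zero (suc c) (suc d) e =
      length-roots≤0 zero zero (suc c) (suc d) e p∣0 p∣0
        (∤∧∤⇒∤* p-prime (∤toℤ-suc² c) (∤toℤ-suc² d) ∘
          subst (+ suc q ∣_) (constant-coefficient-at-a≡b≡0 (toℤ (suc c)) (toℤ (suc d)) (toℤ e)))
    length-roots≤rootBound zero (suc b) c       zero e = length-roots≤p zero (suc b) c zero e
    length-roots≤rootBound zero zero    zero    d    e = length-roots≤p zero zero zero d e
    length-roots≤rootBound zero zero    (suc c) zero e = length-roots≤p zero zero (suc c) zero e

open import Data.Nat using (_+_; _*_; _∸_; _^_)
open import Data.Nat.Tactic.RingSolver using (solve-∀)

totalRootBound : ℕ → ℕ
totalRootBound q =
  ∑[ a < suc q ] ∑[ b < suc q ] ∑[ c < suc q ] ∑[ d < suc q ] ∑[ e < suc q ] rootBound a b c d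

zeroCount≤totalRootBound : ∀ {q} → Prime (suc q) → zeroCount (suc q) ≤ totalRootBound q
zeroCount≤totalRootBound {q} p-prime =
  split (RZero? (suc q)) (F ⊗ (F ⊗ (F ⊗ (F ⊗ F)))) λ a →
  split (λ y → RZero? (suc q) (a , y)) (F ⊗ (F ⊗ (F ⊗ F))) λ b →
  split (λ y → RZero? (suc q) (a , b , y)) (F ⊗ (F ⊗ F)) λ c →
  split (λ y → RZero? (suc q) (a , b , c , y)) (F ⊗ F) λ d →
  split (λ y → RZero? (suc q) (a , b , c , d , y)) F λ e →
  length-roots≤rootBound p-prime a b c d e
  where
  split : ∀ {B : Set} {P : Pred (Fin (suc q) × B) 0ℓ} (P? : Decidable P) ys {g} →
          (∀ i → length (filter (λ y → P? (i , y)) ys) ≤ g i) →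
          length (filter P? (cartesianProduct (allFin (suc q)) ys)) ≤ ∑[ i < suc q ] g i
  split P? = length-filter-cartesianProduct≤ P? id
  F : List (Fin (suc q))
  F = allFin (suc q)
  _⊗_ : ∀ {A B : Set} → List A → List B → List (A × B)
  _⊗_ = cartesianProduct

totalRootBound≡ : ∀ q → let p = suc q in
  totalRootBound q ≡ p * (p * p) + q * (p * p + q * (p * 0)) + q * (p * (p * p + q * (p * 1)))
                     + q * (p * (p * (p * (p * 2))))
totalRootBound≡ q = cong₂ _+_ (cong₂ _+_ a≡b≡0 (∑-const q a≡0≢b)) (∑-const q a≢0)
  where
  p : ℕ
  p = suc q
  a≡b≡0≢c : ∀ c → ∑[ d < p ] ∑[ e < p ] rootBound zero zero (suc c) d ≡ p * p + q * (p * 0)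
  a≡b≡0≢c _ = cong₂ _+_ (∑-const p λ _ → refl) (∑-const q λ _ → ∑-const p λ _ → refl)
  a≡b≡0 : ∑[ c < p ] ∑[ d < p ] ∑[ e < p ] rootBound zero zero c d ≡
          p * (p * p) + q * (p * p + q * (p * 0))
  a≡b≡0 = cong₂ _+_ (∑-const p λ _ → ∑-const p λ _ → refl) (∑-const q a≡b≡0≢c)
  a≡0≢b : ∀ b → ∑[ c < p ] ∑[ d < p ] ∑[ e < p ] rootBound zero (suc b) c d ≡
                p * (p * p + q * (p * 1))
  a≡0≢b _ = ∑-const p λ _ →
    cong₂ _+_ (∑-const p λ _ → refl) (∑-const q λ _ → ∑-const p λ _ → refl)
  a≢0 : ∀ a → ∑[ b < p ] ∑[ c < p ] ∑[ d < p ] ∑[ e < p ] rootBound (suc a) b c d ≡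
              p * (p * (p * (p * 2)))
  a≢0 _ = ∑-const p λ _ → ∑-const p λ _ → ∑-const p λ _ → ∑-const p λ _ → refl

totalRootBound+p³≡2p⁵ : ∀ q → totalRootBound q + suc q ^ 3 ≡ 2 * suc q ^ 5
totalRootBound+p³≡2p⁵ q = trans (cong (_+ suc q ^ 3) (totalRootBound≡ q)) (polynomial q)
  where
  -- ℕ's _^_ is opaque to the ring solver, so the powers are written out.
  polynomial : ∀ q → let p = suc q in
    p * (p * p) + q * (p * p + q * (p * 0)) + q * (p * (p * p + q * (p * 1)))
    + q * (p * (p * (p * (p * 2)))) + p * (p * (p * 1)) ≡ 2 * (p * (p * (p * (p * (p * 1)))))
  polynomial = solve-∀

proposition5p2 : (p : ℕ) (pp : Prime p) →
    zeroCount p {{prime⇒nonZero pp}} ≤ 2 * p ^ 5 ∸ p ^ 3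
proposition5p2 zero    _       = z≤n
proposition5p2 (suc q) p-prime = ≤-trans (zeroCount≤totalRootBound p-prime)
  (m+n≤o⇒m≤o∸n (totalRootBound q) (≤-reflexive (totalRootBound+p³≡2p⁵ q)))
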